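{- Let $N$ be a natural number and let $q,c,e,z$ be complex numbers with $e\ne0$ and such that no denominator below vanishes. Then \[ \sum_{n=1}^N \begin{bmatrix} N\\ n \end{bmatrix} \frac{(q)_n (q/e)_{n-1} (zc)^n e^{n-1} q^{n^2} }{(zq)_n(cq)_n(q)_{n-1}} = \frac{z}{(cq)_N} \sum_{n=1}^N \begin{bmatrix} N\\ n \end{bmatrix} \frac{(q)_n (ceq)_{N-n} (q/e)_{n-1}(cq)^n e^{n-1}}{(zq)_{n}(q)_{n-1}}. \]
   Context: For complex $x$: $(x)_0=1$, $(x)_n=(1-x)(1-xq)\cdots(1-xq^{n-1})$ for $n\ge1$. The $q$-binomial coefficient is $\begin{bmatrix} N\\ n \end{bmatrix}=\frac{(q)_N}{(q)_n(q)_{N-n}}$ for $0\le n\le N$ and $0$ otherwise. -}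

module Defs where

open import Level using (Level; _⊔_)
open import Data.Nat as ℕ using (ℕ; zero; suc; _∸_; _≤?_)
open import Relation.Nullary using (¬_; yes; no)
open import Algebra.Bundles using (CommutativeRing)

-- A field: a commutative ring with 0 ≠ 1 and a (total) inverse operation
-- that is a genuine multiplicative inverse on every nonzero element.
-- (The value of 0⁻¹ is irrelevant: it never occurs under our hypotheses.)
record Field (c ℓ : Level) : Set (Level.suc (c ⊔ ℓ)) where
  field
    commutativeRing : CommutativeRing c ℓ
  open CommutativeRing commutativeRing public
  field
    _⁻¹       : Carrier → Carrier
    0≉1       : ¬ (0# ≈ 1#)
    ⁻¹-inverse : ∀ x → ¬ (x ≈ 0#) → x * (x ⁻¹) ≈ 1#

module FieldOps {c ℓ : Level} (F : Field c ℓ) where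
  open Field F

  infixl 7 _/_
  _/_ : Carrier → Carrier → Carrier
  x / y = x * (y ⁻¹)

  infixr 8 _^_
  _^_ : Carrier → ℕ → Carrier
  x ^ zero  = 1#
  x ^ suc n = x * (x ^ n)

  fromℕ : ℕ → Carrier
  fromℕ zero    = 0#
  fromℕ (suc n) = 1# + fromℕ n

  CharZero : Set ℓ
  CharZero = ∀ n → ¬ (fromℕ (suc n) ≈ 0#)

  poch : (q x : Carrier) → ℕ → Carrier
  poch q x zero    = 1#
  poch q x (suc n) = poch q x n * (1# - x * (q ^ n))

  qbinom : (q : Carrier) → ℕ → ℕ → Carrier
  qbinom q N n with n ≤? N
  ... | yes _ = poch q q N / (poch q q n * poch q q (N ∸ n))
  ... | no  _ = 0#

  sum1 : ℕ → (ℕ → Carrier) → Carrier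
  sum1 zero    f = 0#
  sum1 (suc N) f = sum1 N f + f (suc N)

-- Put n = i + 1 and N = i + j + 1.  Once the q-binomial coefficient and the Pochhammer
-- symbols (zq)_n, (cq)_n are expanded over (q)_N, (zq)_N, (cq)_N, the n-th summands of the
-- two sides become common prefactors times gauss i j * T (zq) q i j and gauss i j * U (zq) q i j,
-- where gauss i j is the Gaussian coefficient [i+j, i]_q and T, U are products of Pochhammer
-- symbols in two free parameters Z and b (with Y = cq).  Splitting gauss by the q-Pascal
-- rule shows, term by term, that both sums X_M(Z, b) = Σ_{i+j=M} gauss i j * F Z b i j
-- (F = T or U) satisfy
--   X_{M+1}(Z, b) = (1 - Zq^{M+1})(1 - Ybq^M) X_M(Z, b) + q^{M+1}(e - b)ZY X_M(Zq, bq).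
-- As X_0 = 1 in both cases, the two sums agree for every M, Z and b.

module Submission where

open import Defs
open import Level using (Level)
open import Algebra.Bundles using (CommutativeRing)
open import Algebra.Solver.Ring.AlmostCommutativeRing using (fromCommutativeRing; _-Raw-AlmostCommutative⟶_)
open import Data.Integer as ℤ using (ℤ; +_; -[1+_]; _⊖_)
import Data.Integer.Properties as ℤₚ
open import Data.Maybe using (Maybe; just; nothing)
open import Data.Nat as ℕ using (ℕ; zero; suc; _∸_; _≤_; _≤?_)
import Data.Nat.Properties as ℕₚ
import Data.Sign as Sign
open import Relation.Binary.PropositionalEquality as ≡ using (_≡_)
open import Relation.Nullary using (¬_; yes; no; contradiction)

-- The ring solver needs a coefficient ring with decidable equality mapped homomorphically
-- into the carrier; ℤ serves for every commutative ring.
module IntegerCoefficients {c ℓ : Level} (R : CommutativeRing c ℓ) where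
  open CommutativeRing R
  open import Algebra.Properties.Ring ring
    using (-0#≈0#; -‿involutive; -‿distribˡ-*; -‿distribʳ-*; -‿+-comm)
  open import Algebra.Properties.Semiring.Mult.TCOptimised semiring using (_×_; 1+×; ×-homo-+; ×1-homo-*)
  open import Algebra.Properties.CommutativeSemigroup +-commutativeSemigroup using (interchange)
  open import Relation.Binary.Reasoning.Setoid setoid

  -- The optimised _×_ has 1 × 1# = 1# definitionally, so the constant 1 of a solver
  -- equation evaluates to 1# on the nose.
  ⟦_⟧ᶻ : ℤ → Carrier
  ⟦ + n      ⟧ᶻ = n × 1#
  ⟦ -[1+ n ] ⟧ᶻ = - (suc n × 1#)

  ⊖-homo : ∀ m n → ⟦ m ⊖ n ⟧ᶻ ≈ m × 1# - n × 1#
  ⊖-homo m       zero    = sym (trans (+-congˡ -0#≈0#) (+-identityʳ _))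
  ⊖-homo zero    (suc n) = sym (+-identityˡ _)
  ⊖-homo (suc m) (suc n) = begin
    ⟦ suc m ⊖ suc n ⟧ᶻ                    ≡⟨ ≡.cong ⟦_⟧ᶻ (ℤₚ.[1+m]⊖[1+n]≡m⊖n m n) ⟩
    ⟦ m ⊖ n ⟧ᶻ                            ≈⟨ ⊖-homo m n ⟩
    m × 1# - n × 1#                       ≈⟨ +-identityˡ _ ⟨
    0# + (m × 1# - n × 1#)                ≈⟨ +-congʳ (-‿inverseʳ 1#) ⟨
    (1# - 1#) + (m × 1# - n × 1#)         ≈⟨ interchange 1# (- 1#) (m × 1#) (- (n × 1#)) ⟩
    (1# + m × 1#) + (- 1# - n × 1#)       ≈⟨ +-congˡ (-‿+-comm 1# (n × 1#)) ⟩
    (1# + m × 1#) - (1# + n × 1#)         ≈⟨ +-cong (1+× m 1#) (-‿cong (1+× n 1#)) ⟨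
    suc m × 1# - suc n × 1#               ∎

  +-homo : ∀ i j → ⟦ i ℤ.+ j ⟧ᶻ ≈ ⟦ i ⟧ᶻ + ⟦ j ⟧ᶻ
  +-homo (+ m)    (+ n)    = ×-homo-+ 1# m n
  +-homo (+ m)    -[1+ n ] = ⊖-homo m (suc n)
  +-homo -[1+ m ] (+ n)    = trans (⊖-homo n (suc m)) (+-comm _ _)
  +-homo -[1+ m ] -[1+ n ] = begin
    - (suc (suc (m ℕ.+ n)) × 1#)          ≡⟨ ≡.cong (λ k → - (suc k × 1#)) (ℕₚ.+-suc m n) ⟨
    - ((suc m ℕ.+ suc n) × 1#)            ≈⟨ -‿cong (×-homo-+ 1# (suc m) (suc n)) ⟩
    - (suc m × 1# + suc n × 1#)           ≈⟨ -‿+-comm _ _ ⟨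
    - (suc m × 1#) - suc n × 1#           ∎

  -‿homo : ∀ i → ⟦ ℤ.- i ⟧ᶻ ≈ - ⟦ i ⟧ᶻ
  -‿homo (+ zero)  = sym -0#≈0#
  -‿homo (+ suc n) = refl
  -‿homo -[1+ n ]  = sym (-‿involutive _)

  +◃-homo : ∀ n → ⟦ Sign.+ ℤ.◃ n ⟧ᶻ ≈ n × 1#
  +◃-homo zero    = refl
  +◃-homo (suc n) = refl

  -◃-homo : ∀ n → ⟦ Sign.- ℤ.◃ n ⟧ᶻ ≈ - (n × 1#)
  -◃-homo zero    = sym -0#≈0#
  -◃-homo (suc n) = refl

  *-homo : ∀ i j → ⟦ i ℤ.* j ⟧ᶻ ≈ ⟦ i ⟧ᶻ * ⟦ j ⟧ᶻ
  *-homo (+ m)    (+ n)    = trans (+◃-homo (m ℕ.* n)) (×1-homo-* m n)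
  *-homo (+ m)    -[1+ n ] = begin
    ⟦ Sign.- ℤ.◃ m ℕ.* suc n ⟧ᶻ           ≈⟨ -◃-homo (m ℕ.* suc n) ⟩
    - ((m ℕ.* suc n) × 1#)                ≈⟨ -‿cong (×1-homo-* m (suc n)) ⟩
    - (m × 1# * suc n × 1#)               ≈⟨ -‿distribʳ-* _ _ ⟩
    m × 1# * - (suc n × 1#)               ∎
  *-homo -[1+ m ] (+ n)    = begin
    ⟦ Sign.- ℤ.◃ suc m ℕ.* n ⟧ᶻ           ≈⟨ -◃-homo (suc m ℕ.* n) ⟩
    - ((suc m ℕ.* n) × 1#)                ≈⟨ -‿cong (×1-homo-* (suc m) n) ⟩
    - (suc m × 1# * n × 1#)               ≈⟨ -‿distribˡ-* _ _ ⟩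
    - (suc m × 1#) * n × 1#               ∎
  *-homo -[1+ m ] -[1+ n ] = begin
    (suc m ℕ.* suc n) × 1#                ≈⟨ ×1-homo-* (suc m) (suc n) ⟩
    suc m × 1# * suc n × 1#               ≈⟨ -‿involutive _ ⟨
    - - (suc m × 1# * suc n × 1#)         ≈⟨ -‿cong (-‿distribˡ-* _ _) ⟩
    - (- (suc m × 1#) * suc n × 1#)       ≈⟨ -‿distribʳ-* _ _ ⟩
    - (suc m × 1#) * - (suc n × 1#)       ∎

  homomorphism : ℤ.+-*-rawRing -Raw-AlmostCommutative⟶ fromCommutativeRing R
  homomorphism = record
    { ⟦_⟧ = ⟦_⟧ᶻ ; +-homo = +-homo ; *-homo = *-homo ; -‿homo = -‿homo
    ; 0-homo = refl ; 1-homo = refl }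

  ≟-homo : ∀ i j → Maybe (⟦ i ⟧ᶻ ≈ ⟦ j ⟧ᶻ)
  ≟-homo i j with i ℤ.≟ j
  ... | yes i≡j = just (reflexive (≡.cong ⟦_⟧ᶻ i≡j))
  ... | no _    = nothing

  open import Algebra.Solver.Ring ℤ.+-*-rawRing (fromCommutativeRing R) homomorphism ≟-homo public

  :1 : ∀ {n} → Polynomial n
  :1 = con (+ 1)

module QCalculus {a ℓ : Level} (F : Field a ℓ) where
  open Field F
  open FieldOps F
  open IntegerCoefficients commutativeRing using (solve; _:=_; _:+_; _:*_; _:-_; :1)
  open import Algebra.Properties.Ring ring using (x≈y⇒x∙y⁻¹≈ε)
  open import Algebra.Properties.CommutativeSemigroup *-commutativeSemigroup using (x∙yz≈y∙xz; xy∙z≈y∙xz)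
  open import Relation.Binary.Reasoning.Setoid setoid

  ^-homo-* : ∀ x m n → x ^ (m ℕ.+ n) ≈ x ^ m * x ^ n
  ^-homo-* x zero    n = sym (*-identityˡ _)
  ^-homo-* x (suc m) n = trans (*-congˡ (^-homo-* x m n)) (sym (*-assoc _ _ _))

  ^-congˡ : ∀ {x y} n → x ≈ y → x ^ n ≈ y ^ n
  ^-congˡ zero    x≈y = refl
  ^-congˡ (suc n) x≈y = *-cong x≈y (^-congˡ n x≈y)

  ^-distribʳ-* : ∀ x y n → (x * y) ^ n ≈ x ^ n * y ^ n
  ^-distribʳ-* x y zero    = sym (*-identityˡ _)
  ^-distribʳ-* x y (suc n) = trans (*-congˡ (^-distribʳ-* x y n))
    (solve 4 (λ x y xⁿ yⁿ → (x :* y) :* (xⁿ :* yⁿ) := (x :* xⁿ) :* (y :* yⁿ)) refl x y (x ^ n) (y ^ n))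

  ^-suc-square : ∀ x n → x ^ (suc n ℕ.* suc n) ≈ x * (x ^ n * (x ^ n * x ^ (n ℕ.* n)))
  ^-suc-square x n = *-congˡ (begin
    x ^ (n ℕ.+ n ℕ.* suc n)        ≡⟨ ≡.cong (λ k → x ^ (n ℕ.+ k)) (ℕₚ.*-suc n n) ⟩
    x ^ (n ℕ.+ (n ℕ.+ n ℕ.* n))    ≈⟨ ^-homo-* x n _ ⟩
    x ^ n * x ^ (n ℕ.+ n ℕ.* n)    ≈⟨ *-congˡ (^-homo-* x n _) ⟩
    x ^ n * (x ^ n * x ^ (n ℕ.* n)) ∎)

  poch-congʳ : ∀ q {x y} n → x ≈ y → poch q x n ≈ poch q y n
  poch-congʳ q zero    x≈y = refl
  poch-congʳ q (suc n) x≈y = *-cong (poch-congʳ q n x≈y) (+-congˡ (-‿cong (*-congʳ x≈y)))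

  poch-sucˡ : ∀ q x n → poch q x (suc n) ≈ (1# - x) * poch q (x * q) n
  poch-sucˡ q x zero    = solve 1 (λ x → :1 :* (:1 :- x :* :1) := (:1 :- x) :* :1) refl x
  poch-sucˡ q x (suc n) = begin
    poch q x (suc n) * (1# - x * (q * q ^ n))              ≈⟨ *-congʳ (poch-sucˡ q x n) ⟩
    (1# - x) * poch q (x * q) n * (1# - x * (q * q ^ n))  ≈⟨ solve 4 (λ x q qⁿ p →
        (:1 :- x) :* p :* (:1 :- x :* (q :* qⁿ)) := (:1 :- x) :* (p :* (:1 :- x :* q :* qⁿ))) refl x q (q ^ n) (poch q (x * q) n) ⟩
    (1# - x) * poch q (x * q) (suc n)                    ∎

  poch-+ : ∀ q x m n → poch q x (m ℕ.+ n) ≈ poch q x m * poch q (x * q ^ m) n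
  poch-+ q x zero    n = trans (poch-congʳ q n (sym (*-identityʳ x))) (sym (*-identityˡ _))
  poch-+ q x (suc m) n = begin
    poch q x (suc m ℕ.+ n)                                     ≈⟨ poch-sucˡ q x (m ℕ.+ n) ⟩
    (1# - x) * poch q (x * q) (m ℕ.+ n)                        ≈⟨ *-congˡ (poch-+ q (x * q) m n) ⟩
    (1# - x) * (poch q (x * q) m * poch q (x * q * q ^ m) n)   ≈⟨ *-congˡ (*-congˡ (poch-congʳ q n (*-assoc x q (q ^ m)))) ⟩
    (1# - x) * (poch q (x * q) m * poch q (x * q ^ suc m) n)   ≈⟨ *-assoc _ _ _ ⟨
    (1# - x) * poch q (x * q) m * poch q (x * q ^ suc m) n     ≈⟨ *-congʳ (poch-sucˡ q x m) ⟨
    poch q x (suc m) * poch q (x * q ^ suc m) n                ∎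

  ⁻¹-cancelˡ : ∀ {x} y → x ≉ 0# → x ⁻¹ * (x * y) ≈ y
  ⁻¹-cancelˡ {x} y x≉0 = begin
    x ⁻¹ * (x * y)    ≈⟨ solve 3 (λ x x⁻¹ y → x⁻¹ :* (x :* y) := x :* x⁻¹ :* y) refl x (x ⁻¹) y ⟩
    x * x ⁻¹ * y      ≈⟨ *-congʳ (⁻¹-inverse x x≉0) ⟩
    1# * y            ≈⟨ *-identityˡ y ⟩
    y                 ∎

  x*y≉0 : ∀ {x y} → x ≉ 0# → y ≉ 0# → x * y ≉ 0#
  x*y≉0 {x} {y} x≉0 y≉0 xy≈0 =
    y≉0 (trans (sym (⁻¹-cancelˡ y x≉0)) (trans (*-congˡ xy≈0) (zeroʳ _)))

  ⁻¹-unique : ∀ {x y} → x ≉ 0# → x * y ≈ 1# → y ≈ x ⁻¹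
  ⁻¹-unique {x} {y} x≉0 xy≈1 =
    trans (sym (⁻¹-cancelˡ y x≉0)) (trans (*-congˡ xy≈1) (*-identityʳ _))

  ⁻¹-distrib-* : ∀ {x y} → x ≉ 0# → y ≉ 0# → (x * y) ⁻¹ ≈ x ⁻¹ * y ⁻¹
  ⁻¹-distrib-* {x} {y} x≉0 y≉0 = sym (⁻¹-unique (x*y≉0 x≉0 y≉0) (begin
    x * y * (x ⁻¹ * y ⁻¹)        ≈⟨ solve 4 (λ x y x⁻¹ y⁻¹ → x :* y :* (x⁻¹ :* y⁻¹) := x :* x⁻¹ :* (y :* y⁻¹))
                                          refl x y (x ⁻¹) (y ⁻¹) ⟩
    x * x ⁻¹ * (y * y ⁻¹)        ≈⟨ *-cong (⁻¹-inverse x x≉0) (⁻¹-inverse y y≉0) ⟩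
    1# * 1#                      ≈⟨ *-identityʳ 1# ⟩
    1#                           ∎))

  poch-⁻¹ : ∀ q x m n → poch q x m ≉ 0# → poch q x (m ℕ.+ n) ≉ 0# →
            poch q x m ⁻¹ ≈ poch q (x * q ^ m) n * poch q x (m ℕ.+ n) ⁻¹
  poch-⁻¹ q x m n ≉0 ≉0′ = sym (⁻¹-unique ≉0 (begin
    poch q x m * (poch q (x * q ^ m) n * poch q x (m ℕ.+ n) ⁻¹)   ≈⟨ *-assoc _ _ _ ⟨
    poch q x m * poch q (x * q ^ m) n * poch q x (m ℕ.+ n) ⁻¹     ≈⟨ *-congʳ (poch-+ q x m n) ⟨
    poch q x (m ℕ.+ n) * poch q x (m ℕ.+ n) ⁻¹                    ≈⟨ ⁻¹-inverse _ ≉0′ ⟩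
    1#                                                             ∎))

  qbinom-≤ : ∀ q {N n} → n ≤ N → qbinom q N n ≡ poch q q N / (poch q q n * poch q q (N ∸ n))
  qbinom-≤ q {N} {n} n≤N with n ≤? N
  ... | yes _  = ≡.refl
  ... | no n≰N = contradiction n≤N n≰N

  NonVanishing : Carrier → Carrier → ℕ → Set ℓ
  NonVanishing q x N = ∀ n → n ≤ N → poch q x n ≉ 0#

  1+i≤1+i+j : ∀ i j → suc i ≤ suc (i ℕ.+ j)
  1+i≤1+i+j i j = ℕ.s≤s (ℕₚ.m≤m+n i j)

  i≤1+i+j : ∀ i j → i ≤ suc (i ℕ.+ j)
  i≤1+i+j i j = ℕₚ.m≤n⇒m≤1+n (ℕₚ.m≤m+n i j)

  j≤1+i+j : ∀ i j → j ≤ suc (i ℕ.+ j)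
  j≤1+i+j i j = ℕₚ.m≤n⇒m≤1+n (ℕₚ.m≤n+m j i)

  antidiagonalSum : ℕ → (ℕ → ℕ → Carrier) → Carrier
  antidiagonalSum zero    f = f 0 0
  antidiagonalSum (suc M) f = f 0 (suc M) + antidiagonalSum M (λ i j → f (suc i) j)

  antidiagonalSum-cong : ∀ M {f g : ℕ → ℕ → Carrier} →
                         (∀ i j → i ℕ.+ j ≡ M → f i j ≈ g i j) → antidiagonalSum M f ≈ antidiagonalSum M g
  antidiagonalSum-cong zero    f≈g = f≈g 0 0 ≡.refl
  antidiagonalSum-cong (suc M) f≈g =
    +-cong (f≈g 0 (suc M) ≡.refl) (antidiagonalSum-cong M (λ i j i+j≡M → f≈g (suc i) j (≡.cong suc i+j≡M)))

  antidiagonalSum-+ : ∀ M (f g : ℕ → ℕ → Carrier) →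
                      antidiagonalSum M (λ i j → f i j + g i j) ≈ antidiagonalSum M f + antidiagonalSum M g
  antidiagonalSum-+ zero    f g = refl
  antidiagonalSum-+ (suc M) f g = trans (+-congˡ (antidiagonalSum-+ M _ _))
    (solve 4 (λ a b c d → (a :+ b) :+ (c :+ d) := (a :+ c) :+ (b :+ d)) refl _ _ _ _)

  *-distribˡ-antidiagonalSum : ∀ M x (f : ℕ → ℕ → Carrier) →
                               antidiagonalSum M (λ i j → x * f i j) ≈ x * antidiagonalSum M f
  *-distribˡ-antidiagonalSum zero    x f = refl
  *-distribˡ-antidiagonalSum (suc M) x f =
    trans (+-congˡ (*-distribˡ-antidiagonalSum M x _)) (sym (distribˡ _ _ _))

  antidiagonalSum-sucʳ : ∀ M (f : ℕ → ℕ → Carrier) →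
                         antidiagonalSum (suc M) f ≈ antidiagonalSum M (λ i j → f i (suc j)) + f (suc M) 0
  antidiagonalSum-sucʳ zero    f = refl
  antidiagonalSum-sucʳ (suc M) f =
    trans (+-congˡ (antidiagonalSum-sucʳ M (λ i j → f (suc i) j))) (sym (+-assoc _ _ _))

  sum1≈antidiagonalSum : ∀ M (f : ℕ → Carrier) (g : ℕ → ℕ → Carrier) →
                         (∀ i j → i ℕ.+ j ≡ M → f (suc i) ≈ g i j) → sum1 (suc M) f ≈ antidiagonalSum M g
  sum1≈antidiagonalSum zero    f g f≈g = trans (+-identityˡ _) (f≈g 0 0 ≡.refl)
  sum1≈antidiagonalSum (suc M) f g f≈g = begin
    sum1 (suc M) f + f (suc (suc M))
      ≈⟨ +-cong (sum1≈antidiagonalSum M f (λ i j → g i (suc j))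
                  (λ i j i+j≡M → f≈g i (suc j) (≡.trans (ℕₚ.+-suc i j) (≡.cong suc i+j≡M))))
                (f≈g (suc M) 0 (≡.cong suc (ℕₚ.+-identityʳ M))) ⟩
    antidiagonalSum M (λ i j → g i (suc j)) + g (suc M) 0   ≈⟨ antidiagonalSum-sucʳ M g ⟨
    antidiagonalSum (suc M) g                               ∎

  module Gaussian (q : Carrier) where

    gauss : ℕ → ℕ → Carrier
    gauss zero    j       = 1#
    gauss (suc i) zero    = 1#
    gauss (suc i) (suc j) = gauss (suc i) j + q ^ suc j * gauss i (suc j)

    poch-gauss : ∀ i j → poch q q i * poch q q j * gauss i j ≈ poch q q (i ℕ.+ j)
    poch-gauss zero    j       = trans (*-identityʳ _) (*-identityˡ _)
    poch-gauss (suc i) zero    =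
      trans (*-identityʳ _) (trans (*-identityʳ _) (reflexive (≡.cong (poch q q) (≡.sym (ℕₚ.+-identityʳ (suc i))))))
    poch-gauss (suc i) (suc j) = begin
      P (suc i) * P (suc j) * (gauss (suc i) j + q ^ suc j * gauss i (suc j))
        ≈⟨ solve 7 (λ Pᵢ Pⱼ g₁ g₂ q qⁱ qʲ →
             Pᵢ :* (:1 :- q :* qⁱ) :* (Pⱼ :* (:1 :- q :* qʲ)) :* (g₁ :+ q :* qʲ :* g₂)
             := (:1 :- q :* qʲ) :* (Pᵢ :* (:1 :- q :* qⁱ) :* Pⱼ :* g₁) :+ q :* qʲ :* (:1 :- q :* qⁱ) :* (Pᵢ :* (Pⱼ :* (:1 :- q :* qʲ)) :* g₂))
             refl (P i) (P j) (gauss (suc i) j) (gauss i (suc j)) q (q ^ i) (q ^ j) ⟩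
      (1# - q * q ^ j) * (P (suc i) * P j * gauss (suc i) j) + q * q ^ j * (1# - q * q ^ i) * (P i * P (suc j) * gauss i (suc j))
        ≈⟨ +-cong (*-congˡ (poch-gauss (suc i) j)) (*-congˡ (trans (poch-gauss i (suc j)) (reflexive (≡.cong P (ℕₚ.+-suc i j))))) ⟩
      (1# - q * q ^ j) * P (suc (i ℕ.+ j)) + q * q ^ j * (1# - q * q ^ i) * P (suc (i ℕ.+ j))
        ≈⟨ solve 4 (λ X q qⁱ qʲ → (:1 :- q :* qʲ) :* X :+ q :* qʲ :* (:1 :- q :* qⁱ) :* X := X :* (:1 :- q :* (qⁱ :* (q :* qʲ))))
             refl (P (suc (i ℕ.+ j))) q (q ^ i) (q ^ j) ⟩
      P (suc (i ℕ.+ j)) * (1# - q * (q ^ i * q ^ suc j))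
        ≈⟨ *-cong (reflexive (≡.cong P (≡.sym (ℕₚ.+-suc i j)))) (+-congˡ (-‿cong (*-congˡ (sym (^-homo-* q i (suc j)))))) ⟩
      P (suc i ℕ.+ suc j) ∎
      where P = poch q q

    qbinom-gauss : ∀ i j → NonVanishing q q (suc (i ℕ.+ j)) →
                   qbinom q (suc (i ℕ.+ j)) (suc i) * poch q q (suc i) * poch q q i ⁻¹ ≈ (1# - q * q ^ (i ℕ.+ j)) * gauss i j
    qbinom-gauss i j P≉0 = begin
      qbinom q (suc (i ℕ.+ j)) (suc i) * P (suc i) * P i ⁻¹
        ≡⟨ ≡.cong (λ x → x * P (suc i) * P i ⁻¹)
             (≡.trans (qbinom-≤ q (1+i≤1+i+j i j))
                      (≡.cong (λ k → P (suc (i ℕ.+ j)) / (P (suc i) * P k)) (ℕₚ.m+n∸m≡n i j))) ⟩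
      P (i ℕ.+ j) * (1# - q * q ^ (i ℕ.+ j)) * (P (suc i) * P j) ⁻¹ * P (suc i) * P i ⁻¹
        ≈⟨ *-congʳ (*-congʳ (*-congʳ (*-congʳ (poch-gauss i j)))) ⟨
      P i * P j * gauss i j * (1# - q * q ^ (i ℕ.+ j)) * (P (suc i) * P j) ⁻¹ * P (suc i) * P i ⁻¹
        ≈⟨ solve 7 (λ Pᵢ Pⱼ Pᵢ₊₁ g x y Pᵢ⁻¹ →
             Pᵢ :* Pⱼ :* g :* x :* y :* Pᵢ₊₁ :* Pᵢ⁻¹ := x :* g :* (Pᵢ₊₁ :* Pⱼ :* y) :* (Pᵢ :* Pᵢ⁻¹))
           refl (P i) (P j) (P (suc i)) (gauss i j) (1# - q * q ^ (i ℕ.+ j)) ((P (suc i) * P j) ⁻¹) (P i ⁻¹) ⟩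
      (1# - q * q ^ (i ℕ.+ j)) * gauss i j * (P (suc i) * P j * (P (suc i) * P j) ⁻¹) * (P i * P i ⁻¹)
        ≈⟨ *-cong (*-congˡ (⁻¹-inverse _ (x*y≉0 (P≉0 (suc i) (1+i≤1+i+j i j)) (P≉0 j (j≤1+i+j i j)))))
                  (⁻¹-inverse _ (P≉0 i (i≤1+i+j i j))) ⟩
      (1# - q * q ^ (i ℕ.+ j)) * gauss i j * 1# * 1#
        ≈⟨ trans (*-identityʳ _) (*-identityʳ _) ⟩
      (1# - q * q ^ (i ℕ.+ j)) * gauss i j ∎
      where P = poch q q

    antidiagonalSum-pascal : ∀ M (f : ℕ → ℕ → Carrier) →
      antidiagonalSum (suc M) (λ i j → gauss i j * f i j)
      ≈ antidiagonalSum M (λ i j → gauss i j * f i (suc j) + q ^ j * gauss i j * f (suc i) j)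
    antidiagonalSum-pascal M f = begin
      antidiagonalSum (suc M) (λ i j → gauss i j * f i j)
        ≈⟨ antidiagonalSum-cong (suc M) split ⟩
      antidiagonalSum (suc M) (λ i j → pascal₁ i j + pascal₂ i j)
        ≈⟨ antidiagonalSum-+ (suc M) pascal₁ pascal₂ ⟩
      antidiagonalSum (suc M) pascal₁ + (0# + antidiagonalSum M (λ i j → pascal₂ (suc i) j))
        ≈⟨ +-cong (antidiagonalSum-sucʳ M pascal₁) (+-identityˡ _) ⟩
      antidiagonalSum M (λ i j → pascal₁ i (suc j)) + 0# + antidiagonalSum M (λ i j → pascal₂ (suc i) j)
        ≈⟨ +-congʳ (+-identityʳ _) ⟩
      antidiagonalSum M (λ i j → pascal₁ i (suc j)) + antidiagonalSum M (λ i j → pascal₂ (suc i) j)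
        ≈⟨ antidiagonalSum-+ M _ _ ⟨
      antidiagonalSum M (λ i j → gauss i j * f i (suc j) + q ^ j * gauss i j * f (suc i) j) ∎
      where
      pascal₁ pascal₂ : ℕ → ℕ → Carrier
      pascal₁ i       zero    = 0#
      pascal₁ i       (suc j) = gauss i j * f i (suc j)
      pascal₂ zero    j       = 0#
      pascal₂ (suc i) j       = q ^ j * gauss i j * f (suc i) j

      gauss-zeroʳ : ∀ i → gauss i 0 ≈ 1#
      gauss-zeroʳ zero    = refl
      gauss-zeroʳ (suc i) = refl

      split : ∀ i j → i ℕ.+ j ≡ suc M → gauss i j * f i j ≈ pascal₁ i j + pascal₂ i j
      split zero    (suc j) _ = sym (+-identityʳ _)
      split (suc i) zero    _ = begin
        1# * f (suc i) 0                  ≈⟨ *-congʳ (trans (*-identityˡ _) (gauss-zeroʳ i)) ⟨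
        1# * gauss i 0 * f (suc i) 0      ≈⟨ +-identityˡ _ ⟨
        0# + 1# * gauss i 0 * f (suc i) 0 ∎
      split (suc i) (suc j) _ = distribʳ _ _ _

  module Recurrence (q e Y : Carrier) where
    open Gaussian q

    W : Carrier → ℕ → Carrier
    W b zero    = 1#
    W b (suc i) = (e - b) * W (b * q) i

    W-sucʳ : ∀ b i → W b (suc i) ≈ W b i * (e - b * q ^ i)
    W-sucʳ b zero    = solve 2 (λ e b → (e :- b) :* :1 := :1 :* (e :- b :* :1)) refl e b
    W-sucʳ b (suc i) = begin
      (e - b) * W (b * q) (suc i)                   ≈⟨ *-congˡ (W-sucʳ (b * q) i) ⟩
      (e - b) * (W (b * q) i * (e - b * q * q ^ i))  ≈⟨ solve 5 (λ e b w q qⁱ →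
          (e :- b) :* (w :* (e :- b :* q :* qⁱ)) := (e :- b) :* w :* (e :- b :* (q :* qⁱ))) refl e b (W (b * q) i) q (q ^ i) ⟩
      (e - b) * W (b * q) i * (e - b * q ^ suc i)   ∎

    poch-W : e ≉ 0# → ∀ b i → poch q (b * e ⁻¹) i * e ^ i ≈ W b i
    poch-W e≉0 b zero    = *-identityʳ _
    poch-W e≉0 b (suc i) = begin
      poch q (b * e ⁻¹) (suc i) * (e * e ^ i)                    ≈⟨ *-congʳ (poch-sucˡ q (b * e ⁻¹) i) ⟩
      (1# - b * e ⁻¹) * poch q (b * e ⁻¹ * q) i * (e * e ^ i)    ≈⟨ solve 5 (λ b e⁻¹ e p eⁱ →
          (:1 :- b :* e⁻¹) :* p :* (e :* eⁱ) := (e :- b :* (e :* e⁻¹)) :* (p :* eⁱ)) refl b (e ⁻¹) e _ (e ^ i) ⟩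
      (e - b * (e * e ⁻¹)) * (poch q (b * e ⁻¹ * q) i * e ^ i)   ≈⟨ *-cong (+-congˡ (-‿cong (*-congˡ (⁻¹-inverse e e≉0))))
                                                                            (*-congʳ (poch-congʳ q i b/e*q≈b*q/e)) ⟩
      (e - b * 1#) * (poch q (b * q * e ⁻¹) i * e ^ i)          ≈⟨ *-cong (+-congˡ (-‿cong (*-identityʳ b))) (poch-W e≉0 (b * q) i) ⟩
      (e - b) * W (b * q) i                                     ∎
      where
      b/e*q≈b*q/e : b * e ⁻¹ * q ≈ b * q * e ⁻¹
      b/e*q≈b*q/e = solve 3 (λ b e⁻¹ q → b :* e⁻¹ :* q := b :* q :* e⁻¹) refl b (e ⁻¹) q

    c₁ c₂ : Carrier → Carrier → Carrier → Carrier
    c₁ Z b t = (1# - Z * (q * t)) * (1# - Y * (b * t))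
    c₂ Z b t = q * t * (e - b) * Z * Y

    -- q ^ i * q ^ j stands for q ^ (i + j), so that the termwise identities are pure ring identities.
    RecurrenceTermwise : (Carrier → Carrier → ℕ → ℕ → Carrier) → Set (a Level.⊔ ℓ)
    RecurrenceTermwise f = ∀ Z b i j →
      gauss i j * f Z b i (suc j) + q ^ j * gauss i j * f Z b (suc i) j
      ≈ c₁ Z b (q ^ i * q ^ j) * (gauss i j * f Z b i j) + c₂ Z b (q ^ i * q ^ j) * (gauss i j * f (Z * q) (b * q) i j)

    gaussSum : (Carrier → Carrier → ℕ → ℕ → Carrier) → ℕ → Carrier → Carrier → Carrier
    gaussSum f M Z b = antidiagonalSum M (λ i j → gauss i j * f Z b i j)

    gaussSum-suc : ∀ {f} → RecurrenceTermwise f → ∀ M Z b →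
      gaussSum f (suc M) Z b ≈ c₁ Z b (q ^ M) * gaussSum f M Z b + c₂ Z b (q ^ M) * gaussSum f M (Z * q) (b * q)
    gaussSum-suc {f} rec M Z b = begin
      gaussSum f (suc M) Z b
        ≈⟨ antidiagonalSum-pascal M (f Z b) ⟩
      antidiagonalSum M (λ i j → gauss i j * f Z b i (suc j) + q ^ j * gauss i j * f Z b (suc i) j)
        ≈⟨ antidiagonalSum-cong M termwise ⟩
      antidiagonalSum M (λ i j → c₁ Z b (q ^ M) * (gauss i j * f Z b i j) + c₂ Z b (q ^ M) * (gauss i j * f (Z * q) (b * q) i j))
        ≈⟨ antidiagonalSum-+ M _ _ ⟩
      antidiagonalSum M (λ i j → c₁ Z b (q ^ M) * (gauss i j * f Z b i j))
        + antidiagonalSum M (λ i j → c₂ Z b (q ^ M) * (gauss i j * f (Z * q) (b * q) i j))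
        ≈⟨ +-cong (*-distribˡ-antidiagonalSum M _ _) (*-distribˡ-antidiagonalSum M _ _) ⟩
      c₁ Z b (q ^ M) * gaussSum f M Z b + c₂ Z b (q ^ M) * gaussSum f M (Z * q) (b * q) ∎
      where
      c₁-congʳ : ∀ {t u} → t ≈ u → c₁ Z b t ≈ c₁ Z b u
      c₁-congʳ t≈u = *-cong (+-congˡ (-‿cong (*-congˡ (*-congˡ t≈u)))) (+-congˡ (-‿cong (*-congˡ (*-congˡ t≈u))))
      c₂-congʳ : ∀ {t u} → t ≈ u → c₂ Z b t ≈ c₂ Z b u
      c₂-congʳ t≈u = *-congʳ (*-congʳ (*-congʳ (*-congˡ t≈u)))
      termwise : ∀ i j → i ℕ.+ j ≡ M →
        gauss i j * f Z b i (suc j) + q ^ j * gauss i j * f Z b (suc i) j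
        ≈ c₁ Z b (q ^ M) * (gauss i j * f Z b i j) + c₂ Z b (q ^ M) * (gauss i j * f (Z * q) (b * q) i j)
      termwise i j ≡.refl = trans (rec Z b i j)
        (+-cong (*-congʳ (c₁-congʳ (sym (^-homo-* q i j)))) (*-congʳ (c₂-congʳ (sym (^-homo-* q i j)))))

    gaussSum-unique : ∀ {f g} → RecurrenceTermwise f → RecurrenceTermwise g → (∀ Z b → f Z b 0 0 ≈ g Z b 0 0) →
                      ∀ M Z b → gaussSum f M Z b ≈ gaussSum g M Z b
    gaussSum-unique         rec-f rec-g f≈g zero    Z b = *-congˡ (f≈g Z b)
    gaussSum-unique {f} {g} rec-f rec-g f≈g (suc M) Z b = begin
      gaussSum f (suc M) Z b
        ≈⟨ gaussSum-suc rec-f M Z b ⟩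
      c₁ Z b (q ^ M) * gaussSum f M Z b + c₂ Z b (q ^ M) * gaussSum f M (Z * q) (b * q)
        ≈⟨ +-cong (*-congˡ (gaussSum-unique rec-f rec-g f≈g M Z b))
                  (*-congˡ (gaussSum-unique rec-f rec-g f≈g M (Z * q) (b * q))) ⟩
      c₁ Z b (q ^ M) * gaussSum g M Z b + c₂ Z b (q ^ M) * gaussSum g M (Z * q) (b * q)
        ≈⟨ gaussSum-suc rec-g M Z b ⟨
      gaussSum g (suc M) Z b ∎

    T U : Carrier → Carrier → ℕ → ℕ → Carrier
    T Z b i j = W b i * (Z * Y) ^ i * q ^ (i ℕ.* i) * poch q (Z * q ^ suc i) j * poch q (Y * (b * q ^ i)) j
    U Z b i j = W b i * Y ^ i * poch q (Y * e) j * poch q (Z * q ^ suc i) j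

    T-sucʳ : ∀ Z b i j → T Z b i (suc j) ≈ c₁ Z b (q ^ i * q ^ j) * T Z b i j
    T-sucʳ Z b i j = solve 11 (λ w zyⁱ qⁱⁱ p p′ q qⁱ qʲ Z Y b →
        w :* zyⁱ :* qⁱⁱ :* (p :* (:1 :- Z :* (q :* qⁱ) :* qʲ)) :* (p′ :* (:1 :- Y :* (b :* qⁱ) :* qʲ))
        := (:1 :- Z :* (q :* (qⁱ :* qʲ))) :* (:1 :- Y :* (b :* (qⁱ :* qʲ))) :* (w :* zyⁱ :* qⁱⁱ :* p :* p′))
      refl (W b i) ((Z * Y) ^ i) (q ^ (i ℕ.* i)) (poch q (Z * q ^ suc i) j) (poch q (Y * (b * q ^ i)) j) q (q ^ i) (q ^ j) Z Y b

    T-sucˡ : ∀ Z b i j → q ^ j * T Z b (suc i) j ≈ c₂ Z b (q ^ i * q ^ j) * T (Z * q) (b * q) i j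
    T-sucˡ Z b i j = begin
      q ^ j * T Z b (suc i) j
        ≈⟨ *-congˡ (*-cong (*-cong (*-congˡ (^-suc-square q i)) (poch-congʳ q j (sym (*-assoc Z q _))))
                           (poch-congʳ q j (*-congˡ (sym (*-assoc b q _))))) ⟩
      q ^ j * (W b (suc i) * (Z * Y) ^ suc i * (q * (q ^ i * (q ^ i * q ^ (i ℕ.* i)))) * p * p′)
        ≈⟨ solve 12 (λ w zyⁱ qⁱⁱ p p′ q qⁱ qʲ Z Y b e →
             qʲ :* ((e :- b) :* w :* (Z :* Y :* zyⁱ) :* (q :* (qⁱ :* (qⁱ :* qⁱⁱ))) :* p :* p′)
             := q :* (qⁱ :* qʲ) :* (e :- b) :* Z :* Y :* (w :* (zyⁱ :* qⁱ) :* qⁱⁱ :* p :* p′))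
           refl (W (b * q) i) ((Z * Y) ^ i) (q ^ (i ℕ.* i)) p p′ q (q ^ i) (q ^ j) Z Y b e ⟩
      c₂ Z b (q ^ i * q ^ j) * (W (b * q) i * ((Z * Y) ^ i * q ^ i) * q ^ (i ℕ.* i) * p * p′)
        ≈⟨ *-congˡ (*-congʳ (*-congʳ (*-congʳ (*-congˡ (sym Zq*Y^i))))) ⟩
      c₂ Z b (q ^ i * q ^ j) * T (Z * q) (b * q) i j ∎
      where
      p = poch q (Z * q * q ^ suc i) j
      p′ = poch q (Y * (b * q * q ^ i)) j
      Zq*Y^i : (Z * q * Y) ^ i ≈ (Z * Y) ^ i * q ^ i
      Zq*Y^i = trans (^-congˡ i (solve 3 (λ Z q Y → Z :* q :* Y := Z :* Y :* q) refl Z q Y)) (^-distribʳ-* (Z * Y) q i)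

    T-recurrence : RecurrenceTermwise T
    T-recurrence Z b i j = +-cong
      (trans (*-congˡ (T-sucʳ Z b i j)) (x∙yz≈y∙xz _ _ _))
      (trans (xy∙z≈y∙xz _ _ _) (trans (*-congˡ (T-sucˡ Z b i j)) (x∙yz≈y∙xz _ _ _)))

    U-sucʳ : ∀ Z b i j → U Z b i (suc j) ≈ (1# - Y * e * q ^ j) * (1# - Z * (q * q ^ i) * q ^ j) * U Z b i j
    U-sucʳ Z b i j = solve 10 (λ w yⁱ p p′ Y e Z q qⁱ qʲ →
        w :* yⁱ :* (p :* (:1 :- Y :* e :* qʲ)) :* (p′ :* (:1 :- Z :* (q :* qⁱ) :* qʲ))
        := (:1 :- Y :* e :* qʲ) :* (:1 :- Z :* (q :* qⁱ) :* qʲ) :* (w :* yⁱ :* p :* p′))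
      refl (W b i) (Y ^ i) (poch q (Y * e) j) (poch q (Z * q ^ suc i) j) Y e Z q (q ^ i) (q ^ j)

    U-sucˡ : ∀ Z b i j → U Z b (suc i) j ≈ (e - b) * Y * U (Z * q) (b * q) i j
    U-sucˡ Z b i j = begin
      (e - b) * w * (Y * Y ^ i) * p * poch q (Z * q ^ suc (suc i)) j
        ≈⟨ *-congˡ (poch-congʳ q j (sym (*-assoc Z q _))) ⟩
      (e - b) * w * (Y * Y ^ i) * p * poch q (Z * q * q ^ suc i) j
        ≈⟨ solve 7 (λ e b w Y yⁱ p p′ → (e :- b) :* w :* (Y :* yⁱ) :* p :* p′ := (e :- b) :* Y :* (w :* yⁱ :* p :* p′))
             refl e b w Y (Y ^ i) p (poch q (Z * q * q ^ suc i) j) ⟩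
      (e - b) * Y * U (Z * q) (b * q) i j ∎
      where
      w = W (b * q) i
      p = poch q (Y * e) j

    U-shift : ∀ Z b i j → (e - b) * (1# - Z * (q * q ^ i)) * U (Z * q) (b * q) i j
                          ≈ (e - b * q ^ i) * (1# - Z * (q * q ^ i) * q ^ j) * U Z b i j
    U-shift Z b i j = begin
      (e - b) * (1# - x) * (W (b * q) i * Y ^ i * p * poch q (Z * q * q ^ suc i) j)
        ≈⟨ solve 7 (λ e b x w yⁱ p p′ → (e :- b) :* (:1 :- x) :* (w :* yⁱ :* p :* p′) := (e :- b) :* w :* ((:1 :- x) :* p′) :* (yⁱ :* p))
             refl e b x (W (b * q) i) (Y ^ i) p _ ⟩
      W b (suc i) * ((1# - x) * poch q (Z * q * q ^ suc i) j) * (Y ^ i * p)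
        ≈⟨ *-congʳ (*-cong (W-sucʳ b i) (sym (trans (poch-sucˡ q x j) (*-congˡ (poch-congʳ q j x*q≈Zq*qⁱ⁺¹))))) ⟩
      W b i * (e - b * q ^ i) * (poch q x j * (1# - x * q ^ j)) * (Y ^ i * p)
        ≈⟨ solve 6 (λ w f p′ g yⁱ p → w :* f :* (p′ :* g) :* (yⁱ :* p) := f :* g :* (w :* yⁱ :* p :* p′))
             refl (W b i) (e - b * q ^ i) (poch q x j) (1# - x * q ^ j) (Y ^ i) p ⟩
      (e - b * q ^ i) * (1# - x * q ^ j) * U Z b i j ∎
      where
      x = Z * q ^ suc i
      p = poch q (Y * e) j
      x*q≈Zq*qⁱ⁺¹ : x * q ≈ Z * q * q ^ suc i
      x*q≈Zq*qⁱ⁺¹ = solve 3 (λ Z q qⁱ⁺¹ → Z :* qⁱ⁺¹ :* q := Z :* q :* qⁱ⁺¹) refl Z q (q ^ suc i)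

    -- Unlike for T, the two Pascal terms of U do not match the two terms of the recurrence
    -- separately: their discrepancy is a multiple of the relation U-shift.
    U-recurrence : RecurrenceTermwise U
    U-recurrence Z b i j = begin
      G * U Z b i (suc j) + q ^ j * G * U Z b (suc i) j
        ≈⟨ +-cong (*-congˡ (U-sucʳ Z b i j)) (*-congˡ (U-sucˡ Z b i j)) ⟩
      G * ((1# - Y * e * q ^ j) * (1# - Z * (q * q ^ i) * q ^ j) * u) + q ^ j * G * ((e - b) * Y * u′)
        ≈⟨ solve 10 (λ G u u′ Y e b Z q qⁱ qʲ →
             G :* ((:1 :- Y :* e :* qʲ) :* (:1 :- Z :* (q :* qⁱ) :* qʲ) :* u) :+ qʲ :* G :* ((e :- b) :* Y :* u′)
             := (:1 :- Z :* (q :* (qⁱ :* qʲ))) :* (:1 :- Y :* (b :* (qⁱ :* qʲ))) :* (G :* u)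
                :+ q :* (qⁱ :* qʲ) :* (e :- b) :* Z :* Y :* (G :* u′)
                :+ qʲ :* Y :* G :* ((e :- b) :* (:1 :- Z :* (q :* qⁱ)) :* u′ :- (e :- b :* qⁱ) :* (:1 :- Z :* (q :* qⁱ) :* qʲ) :* u))
           refl G u u′ Y e b Z q (q ^ i) (q ^ j) ⟩
      c₁ Z b t * (G * u) + c₂ Z b t * (G * u′) + q ^ j * Y * G * (lhs - rhs)
        ≈⟨ +-congˡ (*-congˡ (x≈y⇒x∙y⁻¹≈ε (U-shift Z b i j))) ⟩
      c₁ Z b t * (G * u) + c₂ Z b t * (G * u′) + q ^ j * Y * G * 0#
        ≈⟨ trans (+-congˡ (zeroʳ _)) (+-identityʳ _) ⟩
      c₁ Z b t * (G * u) + c₂ Z b t * (G * u′) ∎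
      where
      G = gauss i j
      t = q ^ i * q ^ j
      u = U Z b i j
      u′ = U (Z * q) (b * q) i j
      lhs = (e - b) * (1# - Z * (q * q ^ i)) * u′
      rhs = (e - b * q ^ i) * (1# - Z * (q * q ^ i) * q ^ j) * u

    gaussSum-T≈gaussSum-U : ∀ M Z b → gaussSum T M Z b ≈ gaussSum U M Z b
    gaussSum-T≈gaussSum-U = gaussSum-unique T-recurrence U-recurrence
      (λ Z b → solve 0 (:1 :* :1 :* :1 :* :1 :* :1 := :1 :* :1 :* :1 :* :1) refl)

  module Summands (q c e z : Carrier) (e≉0 : e ≉ 0#) where
    open Gaussian q
    open Recurrence q e (c * q)

    summandL summandR : ℕ → ℕ → Carrier
    summandL N n = qbinom q N n
                     * ((poch q q n * poch q (q / e) (n ∸ 1) * (z * c) ^ n * e ^ (n ∸ 1) * q ^ (n ℕ.* n))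
                        / (poch q (z * q) n * poch q (c * q) n * poch q q (n ∸ 1)))
    summandR N n = qbinom q N n
                     * ((poch q q n * poch q (c * e * q) (N ∸ n) * poch q (q / e) (n ∸ 1) * (c * q) ^ n * e ^ (n ∸ 1))
                        / (poch q (z * q) n * poch q q (n ∸ 1)))

    prefactorL prefactorR : ℕ → Carrier
    prefactorL M = (1# - q * q ^ M) * (z * c * q) * (poch q (z * q) (suc M) ⁻¹ * poch q (c * q) (suc M) ⁻¹)
    prefactorR M = (1# - q * q ^ M) * (c * q) * poch q (z * q) (suc M) ⁻¹

    summandL≈ : ∀ i j → NonVanishing q q (suc (i ℕ.+ j)) → NonVanishing q (z * q) (suc (i ℕ.+ j)) →
                NonVanishing q (c * q) (suc (i ℕ.+ j)) →
                summandL (suc (i ℕ.+ j)) (suc i) ≈ prefactorL (i ℕ.+ j) * (gauss i j * T (z * q) q i j)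
    summandL≈ i j Pq≉0 Pzq≉0 Pcq≉0 = begin
      qb * (num * (Pz (suc i) * Pc (suc i) * P i) ⁻¹)
        ≈⟨ *-congˡ (*-congˡ (trans (⁻¹-distrib-* (x*y≉0 Pzᵢ₊₁≉0 Pcᵢ₊₁≉0) Pᵢ≉0) (*-congʳ (⁻¹-distrib-* Pzᵢ₊₁≉0 Pcᵢ₊₁≉0)))) ⟩
      qb * (num * (Pz (suc i) ⁻¹ * Pc (suc i) ⁻¹ * P i ⁻¹))
        ≈⟨ solve 9 (λ qb Pᵢ₊₁ A zcⁱ⁺¹ eⁱ qs Pz⁻¹ Pc⁻¹ Pᵢ⁻¹ →
             qb :* (Pᵢ₊₁ :* A :* zcⁱ⁺¹ :* eⁱ :* qs :* (Pz⁻¹ :* Pc⁻¹ :* Pᵢ⁻¹))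
             := qb :* Pᵢ₊₁ :* Pᵢ⁻¹ :* (A :* eⁱ) :* (zcⁱ⁺¹ :* qs) :* Pz⁻¹ :* Pc⁻¹)
           refl qb (P (suc i)) (poch q (q / e) i) ((z * c) ^ suc i) (e ^ i) (q ^ (suc i ℕ.* suc i)) (Pz (suc i) ⁻¹) (Pc (suc i) ⁻¹) (P i ⁻¹) ⟩
      qb * P (suc i) * P i ⁻¹ * (poch q (q / e) i * e ^ i) * ((z * c) ^ suc i * q ^ (suc i ℕ.* suc i)) * Pz (suc i) ⁻¹ * Pc (suc i) ⁻¹
        ≈⟨ *-cong (*-cong (*-cong (*-cong (qbinom-gauss i j Pq≉0) (poch-W e≉0 q i)) powers)
                          (poch-⁻¹ q (z * q) (suc i) j Pzᵢ₊₁≉0 (Pzq≉0 _ ℕₚ.≤-refl)))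
                  (poch-⁻¹ q (c * q) (suc i) j Pcᵢ₊₁≉0 (Pcq≉0 _ ℕₚ.≤-refl)) ⟩
      (1# - q * q ^ M) * gauss i j * W q i * (z * c * q * ((z * q * (c * q)) ^ i * q ^ (i ℕ.* i)))
        * (pz * Pz (suc M) ⁻¹) * (pc * Pc (suc M) ⁻¹)
        ≈⟨ solve 12 (λ x G w z c q y qⁱⁱ pz pc Pz⁻¹ Pc⁻¹ →
             x :* G :* w :* (z :* c :* q :* (y :* qⁱⁱ)) :* (pz :* Pz⁻¹) :* (pc :* Pc⁻¹)
             := x :* (z :* c :* q) :* (Pz⁻¹ :* Pc⁻¹) :* (G :* (w :* y :* qⁱⁱ :* pz :* pc)))
           refl (1# - q * q ^ M) (gauss i j) (W q i) z c q ((z * q * (c * q)) ^ i) (q ^ (i ℕ.* i)) pz pc (Pz (suc M) ⁻¹) (Pc (suc M) ⁻¹) ⟩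
      prefactorL M * (gauss i j * T (z * q) q i j) ∎
      where
      M = i ℕ.+ j
      P = poch q q
      Pz = poch q (z * q)
      Pc = poch q (c * q)
      qb = qbinom q (suc M) (suc i)
      Pᵢ≉0 = Pq≉0 i (i≤1+i+j i j)
      Pzᵢ₊₁≉0 = Pzq≉0 (suc i) (1+i≤1+i+j i j)
      Pcᵢ₊₁≉0 = Pcq≉0 (suc i) (1+i≤1+i+j i j)
      num = P (suc i) * poch q (q / e) i * (z * c) ^ suc i * e ^ i * q ^ (suc i ℕ.* suc i)
      pz = poch q (z * q * q ^ suc i) j
      pc = poch q (c * q * q ^ suc i) j
      powers : (z * c) ^ suc i * q ^ (suc i ℕ.* suc i) ≈ z * c * q * ((z * q * (c * q)) ^ i * q ^ (i ℕ.* i))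
      powers = begin
        (z * c) ^ suc i * q ^ (suc i ℕ.* suc i)
          ≈⟨ *-congˡ (^-suc-square q i) ⟩
        z * c * (z * c) ^ i * (q * (q ^ i * (q ^ i * q ^ (i ℕ.* i))))
          ≈⟨ solve 6 (λ z c zcⁱ q qⁱ qⁱⁱ → z :* c :* zcⁱ :* (q :* (qⁱ :* (qⁱ :* qⁱⁱ))) := z :* c :* q :* (zcⁱ :* (qⁱ :* qⁱ) :* qⁱⁱ))
               refl z c ((z * c) ^ i) q (q ^ i) (q ^ (i ℕ.* i)) ⟩
        z * c * q * ((z * c) ^ i * (q ^ i * q ^ i) * q ^ (i ℕ.* i))
          ≈⟨ *-congˡ (*-congʳ (sym zqcq^i)) ⟩
        z * c * q * ((z * q * (c * q)) ^ i * q ^ (i ℕ.* i)) ∎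
        where
        zqcq^i : (z * q * (c * q)) ^ i ≈ (z * c) ^ i * (q ^ i * q ^ i)
        zqcq^i = begin
          (z * q * (c * q)) ^ i      ≈⟨ ^-congˡ i (solve 3 (λ z c q → z :* q :* (c :* q) := z :* c :* (q :* q)) refl z c q) ⟩
          (z * c * (q * q)) ^ i      ≈⟨ ^-distribʳ-* (z * c) (q * q) i ⟩
          (z * c) ^ i * (q * q) ^ i  ≈⟨ *-congˡ (^-distribʳ-* q q i) ⟩
          (z * c) ^ i * (q ^ i * q ^ i) ∎

    summandR≈ : ∀ i j → NonVanishing q q (suc (i ℕ.+ j)) → NonVanishing q (z * q) (suc (i ℕ.+ j)) →
                summandR (suc (i ℕ.+ j)) (suc i) ≈ prefactorR (i ℕ.+ j) * (gauss i j * U (z * q) q i j)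
    summandR≈ i j Pq≉0 Pzq≉0 = begin
      qb * (num * (Pz (suc i) * P i) ⁻¹)
        ≈⟨ *-congˡ (*-congˡ (⁻¹-distrib-* (Pzq≉0 (suc i) (1+i≤1+i+j i j)) (Pq≉0 i (i≤1+i+j i j)))) ⟩
      qb * (num * (Pz (suc i) ⁻¹ * P i ⁻¹))
        ≈⟨ solve 10 (λ qb Pᵢ₊₁ p A c q cqⁱ eⁱ Pz⁻¹ Pᵢ⁻¹ →
             qb :* (Pᵢ₊₁ :* p :* A :* (c :* q :* cqⁱ) :* eⁱ :* (Pz⁻¹ :* Pᵢ⁻¹))
             := qb :* Pᵢ₊₁ :* Pᵢ⁻¹ :* (A :* eⁱ) :* (c :* q :* cqⁱ) :* p :* Pz⁻¹)
           refl qb (P (suc i)) (poch q (c * e * q) (M ∸ i)) (poch q (q / e) i) c q ((c * q) ^ i) (e ^ i) (Pz (suc i) ⁻¹) (P i ⁻¹) ⟩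
      qb * P (suc i) * P i ⁻¹ * (poch q (q / e) i * e ^ i) * (c * q) ^ suc i * poch q (c * e * q) (M ∸ i) * Pz (suc i) ⁻¹
        ≈⟨ *-cong (*-cong (*-congʳ (*-cong (qbinom-gauss i j Pq≉0) (poch-W e≉0 q i))) pce≈pe)
                  (poch-⁻¹ q (z * q) (suc i) j (Pzq≉0 (suc i) (1+i≤1+i+j i j)) (Pzq≉0 _ ℕₚ.≤-refl)) ⟩
      (1# - q * q ^ M) * gauss i j * W q i * (c * q) ^ suc i * pe * (pz * Pz (suc M) ⁻¹)
        ≈⟨ solve 9 (λ x G w c q cqⁱ pe pz Pz⁻¹ →
             x :* G :* w :* (c :* q :* cqⁱ) :* pe :* (pz :* Pz⁻¹)
             := x :* (c :* q) :* Pz⁻¹ :* (G :* (w :* cqⁱ :* pe :* pz)))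
           refl (1# - q * q ^ M) (gauss i j) (W q i) c q ((c * q) ^ i) pe pz (Pz (suc M) ⁻¹) ⟩
      prefactorR M * (gauss i j * U (z * q) q i j) ∎
      where
      M = i ℕ.+ j
      P = poch q q
      Pz = poch q (z * q)
      qb = qbinom q (suc M) (suc i)
      num = P (suc i) * poch q (c * e * q) (M ∸ i) * poch q (q / e) i * (c * q) ^ suc i * e ^ i
      pe = poch q (c * q * e) j
      pz = poch q (z * q * q ^ suc i) j
      pce≈pe : poch q (c * e * q) (M ∸ i) ≈ pe
      pce≈pe = trans (reflexive (≡.cong (poch q (c * e * q)) (ℕₚ.m+n∸m≡n i j)))
                     (poch-congʳ q j (solve 3 (λ c e q → c :* e :* q := c :* q :* e) refl c e q))

    prefactorL≈ : ∀ M → prefactorL M ≈ z / poch q (c * q) (suc M) * prefactorR M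
    prefactorL≈ M = solve 6 (λ x z c q Pz⁻¹ Pc⁻¹ →
        x :* (z :* c :* q) :* (Pz⁻¹ :* Pc⁻¹) := z :* Pc⁻¹ :* (x :* (c :* q) :* Pz⁻¹))
      refl (1# - q * q ^ M) z c q (poch q (z * q) (suc M) ⁻¹) (poch q (c * q) (suc M) ⁻¹)

corollary2p7 : {a ℓ : Level} (F : Field a ℓ) →
    let open Field F
        open FieldOps F
    in CharZero →
       (N : ℕ) (q c e z : Carrier) →
       ¬ (e ≈ 0#) →
       (∀ n → n ≤ N → ¬ (poch q q n ≈ 0#)) →
       (∀ n → n ≤ N → ¬ (poch q (z * q) n ≈ 0#)) →
       (∀ n → n ≤ N → ¬ (poch q (c * q) n ≈ 0#)) →
       sum1 N (λ n → qbinom q N n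
                     * ((poch q q n * poch q (q / e) (n ∸ 1) * (z * c) ^ n * e ^ (n ∸ 1) * q ^ (n ℕ.* n))
                        / (poch q (z * q) n * poch q (c * q) n * poch q q (n ∸ 1))))
       ≈ (z / poch q (c * q) N)
         * sum1 N (λ n → qbinom q N n
                     * ((poch q q n * poch q (c * e * q) (N ∸ n) * poch q (q / e) (n ∸ 1) * (c * q) ^ n * e ^ (n ∸ 1))
                        / (poch q (z * q) n * poch q q (n ∸ 1))))
corollary2p7 F _ zero    q c e z _   _     _      _      = sym (zeroʳ _)
  where open Field F
corollary2p7 F _ (suc M) q c e z e≉0 Pq≉0 Pzq≉0 Pcq≉0 = begin
  sum1 (suc M) (summandL (suc M))
    ≈⟨ sum1≈antidiagonalSum M _ _ (λ { i j ≡.refl → summandL≈ i j Pq≉0 Pzq≉0 Pcq≉0 }) ⟩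
  antidiagonalSum M (λ i j → prefactorL M * (gauss i j * T (z * q) q i j))
    ≈⟨ *-distribˡ-antidiagonalSum M _ _ ⟩
  prefactorL M * gaussSum T M (z * q) q
    ≈⟨ *-cong (prefactorL≈ M) (gaussSum-T≈gaussSum-U M (z * q) q) ⟩
  z / poch q (c * q) (suc M) * prefactorR M * gaussSum U M (z * q) q
    ≈⟨ *-assoc _ _ _ ⟩
  z / poch q (c * q) (suc M) * (prefactorR M * gaussSum U M (z * q) q)
    ≈⟨ *-congˡ (*-distribˡ-antidiagonalSum M _ _) ⟨
  z / poch q (c * q) (suc M) * antidiagonalSum M (λ i j → prefactorR M * (gauss i j * U (z * q) q i j))
    ≈⟨ *-congˡ (sum1≈antidiagonalSum M _ _ (λ { i j ≡.refl → summandR≈ i j Pq≉0 Pzq≉0 })) ⟨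
  z / poch q (c * q) (suc M) * sum1 (suc M) (summandR (suc M)) ∎
  where
  open Field F
  open FieldOps F
  open QCalculus F
  open Gaussian q
  open Recurrence q e (c * q)
  open Summands q c e z e≉0
  open import Relation.Binary.Reasoning.Setoid setoid
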